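{- Let $n\ge 3$ be an integer and let $L_n\colon\mathbb F_2^n\to\mathbb F_2^n$ be the SDS map $[C_n,\mathrm{parity}_3,\mathrm{id}]$. The invariant factor decomposition of $L_n$ (as an $\mathbb F_2$-linear map) is $x+1,\ x^{n-1}-1$ if $n$ is even, and is the single polynomial $(x+1)(x^{n-1}-1)$ if $n$ is odd. In particular, if $n$ is odd then the minimal polynomial of $L_n$ equals its characteristic polynomial.
   Context: $C_n$ is the cycle graph with vertices $v_1,\dots,v_n$, where $v_i$ and $v_j$ are adjacent iff $i-j\equiv\pm1\pmod n$. The map $\mathrm{parity}_3\colon\mathbb F_2^3\to\mathbb F_2$ is $(x,y,z)\mapsto x+y+z$. For $x=(x_1,\dots,x_n)\in\mathbb F_2^n$, the local update $F_{v_i}$ replaces the $i$-th coordinate $x_i$ by $x_{i-1}+x_i+x_{i+1}$ (indices mod $n$) and leaves the other coordinates unchanged; the SDS map with identity update order is $[C_n,\mathrm{parity}_3,\mathrm{id}]=F_{v_n}\circ\cdots\circ F_{v_1}$. This map is $\mathbb F_2$-linear. The invariant factor decomposition of a linear map $L$ on a finite-dimensional $\mathbb F_2$-space $V$ is the sequence of monic polynomials $\alpha_1\mid\cdots\mid\alpha_t$ with $V\cong\bigoplus_i\mathbb F_2[x]/(\alpha_i)$ as $\mathbb F_2[x]$-modules (with $x$ acting as $L$). -}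

module Defs where

open import Data.Bool using (Bool; true; false; _xor_; _∧_; if_then_else_)
open import Data.Nat using (ℕ; zero; suc; _+_; _*_; _∸_; _≤_; NonZero)
open import Data.Nat.DivMod using (_%_; m%n<n)
open import Data.Fin using (Fin; toℕ; fromℕ<)
open import Data.Vec using (Vec; []; _∷_; lookup; _[_]≔_; zipWith; replicate; init; last; map; tabulate)
open import Data.List using (List; []; _∷_; foldl; allFin)
open import Data.Product using (_×_; _,_; ∃; Σ)
open import Data.Unit using (⊤; tt)
open import Function.Definitions using (Bijective)
open import Relation.Binary.PropositionalEquality using (_≡_)

-- 𝔽₂ is Bool with _xor_ as addition and _∧_ as multiplication.
-- 𝔽₂ⁿ is Vec Bool n.

_⊕_ : ∀ {n} → Vec Bool n → Vec Bool n → Vec Bool n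
_⊕_ = zipWith _xor_

-- The SDS map [C_n, parity_3, id].  Vertex v_{i+1} is index i : Fin n.

idx : (n : ℕ) .{{_ : NonZero n}} → ℕ → Fin n
idx n m = fromℕ< (m%n<n m n)

-- local update F_{v_i}: replace x_i by x_{i-1} + x_i + x_{i+1}
localUpdate : (n : ℕ) .{{_ : NonZero n}} → Fin n → Vec Bool n → Vec Bool n
localUpdate n i x =
  x [ i ]≔ (lookup x (idx n (toℕ i + (n ∸ 1))) xor lookup x i xor lookup x (idx n (suc (toℕ i))))

-- SDS map F_{v_n} ∘ ⋯ ∘ F_{v_1} (F_{v_1} applied first)
sdsParity : (n : ℕ) .{{_ : NonZero n}} → Vec Bool n → Vec Bool n
sdsParity n x = foldl (λ y i → localUpdate n i y) x (allFin n)

-- Polynomials over 𝔽₂: coefficient lists, lowest degree first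
-- (trailing zeros allowed; equality is coefficientwise).

Poly : Set
Poly = List Bool

coeff : ℕ → Poly → Bool
coeff k       []       = false
coeff zero    (c ∷ cs) = c
coeff (suc k) (c ∷ cs) = coeff k cs

_≈P_ : Poly → Poly → Set
p ≈P q = ∀ k → coeff k p ≡ coeff k q

-- degree = index of the last nonzero coefficient (0 for the zero polynomial)
isZeroP : Poly → Bool
isZeroP []       = true
isZeroP (c ∷ cs) = if c then false else isZeroP cs

deg : Poly → ℕ
deg []       = 0
deg (c ∷ cs) = if isZeroP cs then 0 else suc (deg cs)

_+P_ : Poly → Poly → Poly
[]       +P q        = q
(c ∷ cs) +P []       = c ∷ cs
(c ∷ cs) +P (d ∷ ds) = (c xor d) ∷ (cs +P ds)

scale : Bool → Poly → Poly
scale false p = []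
scale true  p = p

_*P_ : Poly → Poly → Poly
[]       *P q = []
(c ∷ cs) *P q = scale c q +P (false ∷ (cs *P q))

oneP : Poly
oneP = true ∷ []

X : Poly
X = false ∷ true ∷ []

_^P_ : Poly → ℕ → Poly
p ^P zero  = oneP
p ^P suc k = p *P (p ^P k)

_∣P_ : Poly → Poly → Set
a ∣P b = ∃ λ q → (q *P a) ≈P b

-- over 𝔽₂ "monic" = nonzero: the leading coefficient is 1
Monic : Poly → Set
Monic p = coeff (deg p) p ≡ true

-- The 𝔽₂[x]-module 𝔽₂[x]/(p) for monic p of degree d, written in the
-- basis 1, x, …, x^{d-1}: carrier Vec Bool d, x acts by
--   x · Σ rᵢ xⁱ = Σ rᵢ x^{i+1},  reducing x^d = Σ_{i<d} pᵢ xⁱ.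

lowerCoeffs : (d : ℕ) → Poly → Vec Bool d
lowerCoeffs d p = tabulate (λ i → coeff (toℕ i) p)

xQuot : (d : ℕ) → Poly → Vec Bool d → Vec Bool d
xQuot zero    p r = []
xQuot (suc e) p r = zipWith _xor_ (false ∷ init r) (map (λ c → last r ∧ c) (lowerCoeffs (suc e) p))

Quot : Poly → Set
Quot p = Vec Bool (deg p)

DSum : List Poly → Set
DSum []       = ⊤
DSum (p ∷ ps) = Quot p × DSum ps

addDS : (ps : List Poly) → DSum ps → DSum ps → DSum ps
addDS []       tt       tt       = tt
addDS (p ∷ ps) (r , rs) (s , ss) = (r ⊕ s) , addDS ps rs ss

xDS : (ps : List Poly) → DSum ps → DSum ps
xDS []       tt       = tt
xDS (p ∷ ps) (r , rs) = xQuot (deg p) p r , xDS ps rs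

data Chain : List Poly → Set where
  []  : Chain []
  [_] : ∀ {p} → Monic p → Chain (p ∷ [])
  _∷_ : ∀ {p q ps} → Monic p × p ∣P q → Chain (q ∷ ps) → Chain (p ∷ q ∷ ps)

-- αs is the invariant factor decomposition of L on 𝔽₂ⁿ:
-- α₁ ∣ ⋯ ∣ α_t monic, and 𝔽₂ⁿ ≅ ⊕ᵢ 𝔽₂[x]/(αᵢ) as 𝔽₂[x]-modules (x acting as L),
-- i.e. an additive (hence 𝔽₂-linear) bijection intertwining L with x.
IsInvariantFactorDecomposition : (n : ℕ) → (Vec Bool n → Vec Bool n) → List Poly → Set
IsInvariantFactorDecomposition n L αs =
  Chain αs ×
  Σ (Vec Bool n → DSum αs) λ φ →
      Bijective _≡_ _≡_ φ
    × (∀ u v → φ (u ⊕ v) ≡ addDS αs (φ u) (φ v))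
    × (∀ v → φ (L v) ≡ xDS αs (φ v))

evalAt : ∀ {n} → Poly → (Vec Bool n → Vec Bool n) → Vec Bool n → Vec Bool n
evalAt []       L v = replicate _ false
evalAt (c ∷ cs) L v = (if c then v else replicate _ false) ⊕ evalAt cs L (L v)

Annihilates : ∀ {n} → Poly → (Vec Bool n → Vec Bool n) → Set
Annihilates {n} p L = ∀ v → evalAt p L v ≡ replicate n false

IsMinimalPolynomial : ∀ {n} → Poly → (Vec Bool n → Vec Bool n) → Set
IsMinimalPolynomial p L =
  Monic p × Annihilates p L × (∀ q → Monic q → Annihilates q L → deg p ≤ deg q)

-- Write x = (x₀, …, x_m) with m = n - 1. One sweep of the sequential update gives
-- L x = (c + x₁, c + x₂, …, c + x_m, x₁) with c = x₀ + x_m, so L rotates the cyclic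
-- differences x_i + x_{i+1} (i < m): on them it acts as multiplication by x on
-- 𝔽₂[x]/(x^m + 1). A vector is determined by its differences together with one more
-- linear functional. For n even (m odd) the functional x₁ + ⋯ + x_m is L-invariant,
-- which splits off 𝔽₂[x]/(x + 1). For n odd the total parity P satisfies
-- P (L x) = P x + x₀ + x₁, and differences and parity together are coordinates in which
-- L is multiplication by x on 𝔽₂[x]/((x + 1)(x^m + 1)). That module is cyclic, generated
-- by the class of 1, so its modulus is also its minimal polynomial.

module Submission where

open import Defs
open import Data.Bool using (Bool; true; false; not; _xor_; _∧_; if_then_else_; T)
open import Data.Bool.Properties
  using (T-∧; xor-assoc; xor-comm; xor-same; xor-identityʳ; ∧-identityʳ; ∧-zeroʳ; ∧-distribʳ-xor)
open import Data.Empty using (⊥-elim)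
open import Data.Fin using (Fin; toℕ) renaming (zero to fzero; suc to fsuc)
open import Data.Fin.Properties using (toℕ-fromℕ<; toℕ<n)
open import Data.List using ([]; _∷_; foldl; allFin)
import Data.List as List
open import Data.Nat
  using (ℕ; zero; suc; _+_; _*_; _∸_; _≤_; _<_; _≟_; _<?_; _≡ᵇ_; z≤n; s≤s; s≤s⁻¹; NonZero)
open import Data.Nat.DivMod using (_%_; m%n<n; m<n⇒m%n≡m; n%n≡0; [m+n]%n≡m%n)
open import Data.Nat.Properties
open import Data.Sum using (inj₁; inj₂)
open import Data.Product using (_×_; _,_; proj₁; proj₂)
open import Data.Unit using (⊤; tt)
open import Data.Vec using (Vec; []; _∷_; _++_; lookup; _[_]≔_; replicate; init; last; map; tabulate; take; drop)
open import Data.Vec.Properties using (take-zipWith; drop-zipWith; take++drop≡id; ++-injective)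
open import Function using (_∘_; Equivalence)
open import Function.Consequences.Propositional
  using (inverseᵇ⇒bijective; strictlyInverseˡ⇒inverseˡ; strictlyInverseʳ⇒inverseʳ)
open import Relation.Binary.PropositionalEquality
open import Relation.Nullary using (yes; no; contradiction)

Bool^_⇒Bool : ℕ → Set
Bool^ zero  ⇒Bool = Bool
Bool^ suc k ⇒Bool = Bool → Bool^ k ⇒Bool

Agree : ∀ k → Bool^ k ⇒Bool → Bool^ k ⇒Bool → Set
Agree zero    f g = f ≡ g
Agree (suc k) f g = ∀ b → Agree k (f b) (g b)

agree? : ∀ k → Bool^ k ⇒Bool → Bool^ k ⇒Bool → Bool
agree? zero    f g = not (f xor g)
agree? (suc k) f g = agree? k (f true) (g true) ∧ agree? k (f false) (g false)

-- An identity in k Boolean variables, checked on all 2^k assignments: the implicit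
-- argument reduces to ⊤ exactly when it holds. Used point-free (lemma = truthTable k),
-- so that f and g are found by unification.
truthTable : ∀ k {f g : Bool^ k ⇒Bool} {_ : T (agree? k f g)} → Agree k f g
truthTable zero {true}  {true}  = refl
truthTable zero {false} {false} = refl
truthTable (suc k) {f} {g} {ok} true  = truthTable k {f true}  {g true}  {proj₁ (Equivalence.to T-∧ ok)}
truthTable (suc k) {f} {g} {ok} false = truthTable k {f false} {g false} {proj₂ (Equivalence.to T-∧ ok)}

xor-interchange : ∀ a b c d → (a xor b) xor (c xor d) ≡ (a xor c) xor (b xor d)
xor-interchange = truthTable 4

[a+b]+[b+c]≡a+c : ∀ a b c → (a xor b) xor (b xor c) ≡ a xor c
[a+b]+[b+c]≡a+c = truthTable 3

a+[b+a]≡b : ∀ a b → a xor (b xor a) ≡ b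
a+[b+a]≡b = truthTable 2

a+[a+b]≡b : ∀ a b → a xor (a xor b) ≡ b
a+[a+b]≡b = truthTable 2

[c+a]+[c+b]≡a+b : ∀ c a b → (c xor a) xor (c xor b) ≡ a xor b
[c+a]+[c+b]≡a+b = truthTable 3

[[a+b]+b]+c≡a+c : ∀ a b c → ((a xor b) xor b) xor c ≡ a xor c
[[a+b]+b]+c≡a+c = truthTable 3

[a+b]+[a+[b+c]]≡c : ∀ a b c → (a xor b) xor (a xor (b xor c)) ≡ c
[a+b]+[a+[b+c]]≡c = truthTable 3

[c+a]+[[c+b]+a]≡b : ∀ c a b → (c xor a) xor ((c xor b) xor a) ≡ b
[c+a]+[[c+b]+a]≡b = truthTable 3

[a+b]+b≡a : ∀ a b → (a xor b) xor b ≡ a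
[a+b]+b≡a = truthTable 2

a+[b+c]≡[b+a]+c : ∀ a b c → a xor (b xor c) ≡ (b xor a) xor c
a+[b+c]≡[b+a]+c = truthTable 3

[c+a]+[a+[c+b]]≡b : ∀ c a b → (c xor a) xor (a xor (c xor b)) ≡ b
[c+a]+[a+[c+b]]≡b = truthTable 3

a+b≡false⇒a≡b : ∀ {a b} → a xor b ≡ false → a ≡ b
a+b≡false⇒a≡b {true}  {true}  _ = refl
a+b≡false⇒a≡b {false} {false} _ = refl

≡ᵇ-refl : ∀ i → (i ≡ᵇ i) ≡ true
≡ᵇ-refl zero    = refl
≡ᵇ-refl (suc i) = ≡ᵇ-refl i

≢⇒≡ᵇ-false : ∀ {i j} → i ≢ j → (i ≡ᵇ j) ≡ false
≢⇒≡ᵇ-false {zero}  {zero}  i≢j = ⊥-elim (i≢j refl)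
≢⇒≡ᵇ-false {zero}  {suc j} i≢j = refl
≢⇒≡ᵇ-false {suc i} {zero}  i≢j = refl
≢⇒≡ᵇ-false {suc i} {suc j} i≢j = ≢⇒≡ᵇ-false (i≢j ∘ cong suc)

infixl 10 _!_

-- Coordinates indexed by ℕ; out of range they read as false.
_!_ : ∀ {k} → Vec Bool k → ℕ → Bool
[]      ! i     = false
(b ∷ v) ! zero  = b
(b ∷ v) ! suc i = v ! i

tabulateℕ : ∀ k → (ℕ → Bool) → Vec Bool k
tabulateℕ zero    f = []
tabulateℕ (suc k) f = f 0 ∷ tabulateℕ k (f ∘ suc)

zeros : ∀ {k} → Vec Bool k
zeros = replicate _ false

tabulateℕ-false : ∀ k → tabulateℕ k (λ _ → false) ≡ zeros
tabulateℕ-false zero    = refl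
tabulateℕ-false (suc k) = cong (false ∷_) (tabulateℕ-false k)

!-tabulateℕ : ∀ k f {i} → i < k → tabulateℕ k f ! i ≡ f i
!-tabulateℕ (suc k) f {zero}  _         = refl
!-tabulateℕ (suc k) f {suc i} (s≤s i<k) = !-tabulateℕ k (f ∘ suc) i<k

!-tabulate : ∀ k (f : ℕ → Bool) {i} → i < k → tabulate {n = k} (f ∘ toℕ) ! i ≡ f i
!-tabulate (suc k) f {zero}  _         = refl
!-tabulate (suc k) f {suc i} (s≤s i<k) = !-tabulate k (f ∘ suc) i<k

!-extensionality : ∀ {k} {u v : Vec Bool k} → (∀ i → i < k → u ! i ≡ v ! i) → u ≡ v
!-extensionality {u = []}    {[]}    _  = refl
!-extensionality {u = a ∷ u} {b ∷ v} eq =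
  cong₂ _∷_ (eq 0 (s≤s z≤n)) (!-extensionality (λ i i<k → eq (suc i) (s≤s i<k)))

!-⊕ : ∀ {k} (u v : Vec Bool k) i → (u ⊕ v) ! i ≡ u ! i xor v ! i
!-⊕ []      []      i       = refl
!-⊕ (a ∷ u) (b ∷ v) zero    = refl
!-⊕ (a ∷ u) (b ∷ v) (suc i) = !-⊕ u v i

!-zeros : ∀ k i → zeros {k} ! i ≡ false
!-zeros zero    i       = refl
!-zeros (suc k) zero    = refl
!-zeros (suc k) (suc i) = !-zeros k i

!-lookup : ∀ {k} (v : Vec Bool k) i → lookup v i ≡ v ! toℕ i
!-lookup (b ∷ v) fzero    = refl
!-lookup (b ∷ v) (fsuc i) = !-lookup v i

!-updated : ∀ {k} (v : Vec Bool k) i c → (v [ i ]≔ c) ! toℕ i ≡ c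
!-updated (b ∷ v) fzero    c = refl
!-updated (b ∷ v) (fsuc i) c = !-updated v i c

!-updated-other : ∀ {k} (v : Vec Bool k) i c {j} → j ≢ toℕ i → (v [ i ]≔ c) ! j ≡ v ! j
!-updated-other (b ∷ v) fzero    c {zero}  j≢i = ⊥-elim (j≢i refl)
!-updated-other (b ∷ v) fzero    c {suc j} j≢i = refl
!-updated-other (b ∷ v) (fsuc i) c {zero}  j≢i = refl
!-updated-other (b ∷ v) (fsuc i) c {suc j} j≢i = !-updated-other v i c (j≢i ∘ cong suc)

!-map : ∀ {k} (f : Bool → Bool) (v : Vec Bool k) {i} → i < k → map f v ! i ≡ f (v ! i)
!-map f (b ∷ v) {zero}  _         = refl
!-map f (b ∷ v) {suc i} (s≤s i<k) = !-map f v i<k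

!-init : ∀ {k} (v : Vec Bool (suc k)) {i} → i < k → init v ! i ≡ v ! i
!-init {suc k} (b ∷ v) {zero}  _         = refl
!-init {suc k} (b ∷ v) {suc i} (s≤s i<k) = !-init v i<k

last-! : ∀ {k} (v : Vec Bool (suc k)) → last v ≡ v ! k
last-! {zero}  (b ∷ []) = refl
last-! {suc k} (b ∷ v)  = last-! v

⊕-identityˡ : ∀ {k} (v : Vec Bool k) → zeros ⊕ v ≡ v
⊕-identityˡ []      = refl
⊕-identityˡ (a ∷ v) = cong (a ∷_) (⊕-identityˡ v)

⊕-identityʳ : ∀ {k} (v : Vec Bool k) → v ⊕ zeros ≡ v
⊕-identityʳ []      = refl
⊕-identityʳ (a ∷ v) = cong₂ _∷_ (xor-identityʳ a) (⊕-identityʳ v)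

⊕-self : ∀ {k} (v : Vec Bool k) → v ⊕ v ≡ zeros
⊕-self []      = refl
⊕-self (a ∷ v) = cong₂ _∷_ (xor-same a) (⊕-self v)

⊕-assoc : ∀ {k} (u v w : Vec Bool k) → (u ⊕ v) ⊕ w ≡ u ⊕ (v ⊕ w)
⊕-assoc []      []      []      = refl
⊕-assoc (a ∷ u) (b ∷ v) (c ∷ w) = cong₂ _∷_ (xor-assoc a b c) (⊕-assoc u v w)

⊕-interchange : ∀ {k} (a b c d : Vec Bool k) → (a ⊕ b) ⊕ (c ⊕ d) ≡ (a ⊕ c) ⊕ (b ⊕ d)
⊕-interchange []      []      []      []      = refl
⊕-interchange (a ∷ u) (b ∷ v) (c ∷ w) (d ∷ z) =
  cong₂ _∷_ (xor-interchange a b c d) (⊕-interchange u v w z)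

infixr 25 _·_

_·_ : ∀ {k} → Bool → Vec Bool k → Vec Bool k
c · v = if c then v else zeros

!-· : ∀ {k} c (v : Vec Bool k) i → (c · v) ! i ≡ c ∧ v ! i
!-· {k} true  v i = refl
!-· {k} false v i = !-zeros k i

·-⊕ : ∀ {k} c (u v : Vec Bool k) → c · (u ⊕ v) ≡ c · u ⊕ c · v
·-⊕ true  u v = refl
·-⊕ false u v = sym (⊕-self zeros)

·-zeros : ∀ {k} c → c · zeros {k} ≡ zeros
·-zeros true  = refl
·-zeros false = refl

unit : ∀ d → ℕ → Vec Bool d
unit d j = tabulateℕ d (λ i → i ≡ᵇ j)

xorSum : ℕ → (ℕ → Bool) → Bool
xorSum zero    f = false
xorSum (suc k) f = xorSum k f xor f k

xorSum-cong : ∀ k {f g} → (∀ i → i < k → f i ≡ g i) → xorSum k f ≡ xorSum k g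
xorSum-cong zero    eq = refl
xorSum-cong (suc k) eq = cong₂ _xor_ (xorSum-cong k (λ i i<k → eq i (m≤n⇒m≤1+n i<k))) (eq k ≤-refl)

xorSum-xor : ∀ k f g → xorSum k (λ i → f i xor g i) ≡ xorSum k f xor xorSum k g
xorSum-xor zero    f g = refl
xorSum-xor (suc k) f g =
  trans (cong (_xor (f k xor g k)) (xorSum-xor k f g)) (xor-interchange (xorSum k f) (xorSum k g) (f k) (g k))

xorSum-unshift : ∀ k f → xorSum (suc k) f ≡ f 0 xor xorSum k (f ∘ suc)
xorSum-unshift zero    f = sym (xor-identityʳ (f 0))
xorSum-unshift (suc k) f =
  trans (cong (_xor f (suc k)) (xorSum-unshift k f)) (xor-assoc (f 0) _ _)

xorSum-telescope : ∀ k (f : ℕ → Bool) → xorSum k (λ i → f i xor f (suc i)) ≡ f 0 xor f k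
xorSum-telescope zero    f = sym (xor-same (f 0))
xorSum-telescope (suc k) f =
  trans (cong (_xor (f k xor f (suc k))) (xorSum-telescope k f)) ([a+b]+[b+c]≡a+c (f 0) (f k) (f (suc k)))

xorSum-const-double : ∀ k c → xorSum (2 * k) (λ _ → c) ≡ false
xorSum-const-double zero    c = refl
xorSum-const-double (suc k) c = begin
  xorSum (2 * suc k) (λ _ → c)               ≡⟨ cong (λ t → xorSum t (λ _ → c)) (*-suc 2 k) ⟩
  (xorSum (2 * k) (λ _ → c) xor c) xor c     ≡⟨ cong (λ t → (t xor c) xor c) (xorSum-const-double k c) ⟩
  (false xor c) xor c                        ≡⟨ xor-same c ⟩
  false                                      ∎
  where open ≡-Reasoning

-- Polynomials over 𝔽₂

coeff-+P : ∀ p q i → coeff i (p +P q) ≡ coeff i p xor coeff i q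
coeff-+P []       q        i       = refl
coeff-+P (c ∷ cs) []       i       = sym (xor-identityʳ _)
coeff-+P (c ∷ cs) (d ∷ ds) zero    = refl
coeff-+P (c ∷ cs) (d ∷ ds) (suc i) = coeff-+P cs ds i

coeff-[false] : ∀ i → coeff i (false ∷ []) ≡ false
coeff-[false] zero    = refl
coeff-[false] (suc i) = refl

coeff-+P[false] : ∀ q i → coeff i (q +P (false ∷ [])) ≡ coeff i q
coeff-+P[false] q i = trans (coeff-+P q _ i) (trans (cong (coeff i q xor_) (coeff-[false] i)) (xor-identityʳ _))

coeff-X^P : ∀ k i → coeff i (X ^P k) ≡ (i ≡ᵇ k)
coeff-X^P zero    zero    = refl
coeff-X^P zero    (suc i) = refl
coeff-X^P (suc k) zero    = refl
coeff-X^P (suc k) (suc i) = trans (coeff-+P[false] (X ^P k) i) (coeff-X^P k i)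

coeff-[X+1]*P-zero : ∀ q → coeff 0 ((X +P oneP) *P q) ≡ coeff 0 q
coeff-[X+1]*P-zero q = trans (coeff-+P q _ 0) (xor-identityʳ _)

coeff-[X+1]*P-suc : ∀ q i → coeff (suc i) ((X +P oneP) *P q) ≡ coeff i q xor coeff (suc i) q
coeff-[X+1]*P-suc q i =
  trans (coeff-+P q _ (suc i))
    (trans (cong (coeff (suc i) q xor_) (coeff-+P[false] q i)) (xor-comm (coeff (suc i) q) (coeff i q)))

isZeroP⇒coeff : ∀ q → isZeroP q ≡ true → ∀ k → coeff k q ≡ false
isZeroP⇒coeff []           _ k       = refl
isZeroP⇒coeff (false ∷ cs) z zero    = refl
isZeroP⇒coeff (false ∷ cs) z (suc k) = isZeroP⇒coeff cs z k

coeff⇒isZeroP : ∀ q → (∀ k → coeff k q ≡ false) → isZeroP q ≡ true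
coeff⇒isZeroP []           _   = refl
coeff⇒isZeroP (false ∷ cs) q≡0 = coeff⇒isZeroP cs (q≡0 ∘ suc)
coeff⇒isZeroP (true ∷ cs)  q≡0 with () ← q≡0 0

coeff-true⇒isZeroP : ∀ q k → coeff k q ≡ true → isZeroP q ≡ false
coeff-true⇒isZeroP []           k       ()
coeff-true⇒isZeroP (true ∷ cs)  k       _  = refl
coeff-true⇒isZeroP (false ∷ cs) (suc k) qₖ = coeff-true⇒isZeroP cs k qₖ

coeff-above-deg : ∀ q {k} → deg q < k → coeff k q ≡ false
coeff-above-deg []       _ = refl
coeff-above-deg (c ∷ cs) {suc k} d<k with isZeroP cs in z
... | true  = isZeroP⇒coeff cs z k
... | false = coeff-above-deg cs (s≤s⁻¹ d<k)

deg-≡ : ∀ q d → coeff d q ≡ true → (∀ k → d < k → coeff k q ≡ false) → deg q ≡ d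
deg-≡ []       d       ()
deg-≡ (c ∷ cs) zero    _  above rewrite coeff⇒isZeroP cs (λ k → above (suc k) (s≤s z≤n)) = refl
deg-≡ (c ∷ cs) (suc d) q_d above rewrite coeff-true⇒isZeroP cs d q_d =
  cong suc (deg-≡ cs d q_d (λ k d<k → above (suc k) (s≤s d<k)))

monic-deg-≡ : ∀ q d → coeff d q ≡ true → (∀ k → d < k → coeff k q ≡ false) → Monic q
monic-deg-≡ q d q_d above = subst (λ i → coeff i q ≡ true) (sym (deg-≡ q d q_d above)) q_d

coeff-X^P+1 : ∀ m i → coeff i ((X ^P m) +P oneP) ≡ (i ≡ᵇ m) xor (i ≡ᵇ 0)
coeff-X^P+1 m i = trans (coeff-+P (X ^P m) oneP i) (cong₂ _xor_ (coeff-X^P m i) (coeff-X^P 0 i))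

X^P+1-above : ∀ m {i} → m < i → coeff i ((X ^P m) +P oneP) ≡ false
X^P+1-above m {suc i} m<i =
  trans (coeff-X^P+1 m (suc i)) (cong (_xor false) (≢⇒≡ᵇ-false (λ i+1≡m → <-irrefl (sym i+1≡m) m<i)))

X^P+1-top : ∀ m → coeff (suc m) ((X ^P (suc m)) +P oneP) ≡ true
X^P+1-top m = trans (coeff-X^P+1 (suc m) (suc m)) (cong (_xor false) (≡ᵇ-refl m))

deg-X^P+1 : ∀ m → deg ((X ^P (suc m)) +P oneP) ≡ suc m
deg-X^P+1 m = deg-≡ ((X ^P (suc m)) +P oneP) (suc m) (X^P+1-top m) (λ k → X^P+1-above (suc m))

monic-X^P+1 : ∀ m → Monic ((X ^P (suc m)) +P oneP)
monic-X^P+1 m = monic-deg-≡ ((X ^P (suc m)) +P oneP) (suc m) (X^P+1-top m) (λ k → X^P+1-above (suc m))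

-- 1 + x + ⋯ + x^m is the quotient of x^(m+1) + 1 by x + 1.
X+1∣X^P+1 : ∀ m → (X +P oneP) ∣P ((X ^P (suc m)) +P oneP)
X+1∣X^P+1 m = List.replicate (suc m) true , λ i → trans (geometric m i) (sym (coeff-X^P+1 (suc m) i))
  where
  geometric : ∀ m i → coeff i ((List.replicate (suc m) true) *P (X +P oneP)) ≡ (i ≡ᵇ suc m) xor (i ≡ᵇ 0)
  geometric m       zero    = refl
  geometric zero    (suc i) = trans (coeff-+P (X +P oneP) (false ∷ []) (suc i)) (cong (_xor false) (coeff-X^P 0 i))
  geometric (suc m) (suc i) = begin
    coeff (suc i) ((List.replicate (suc (suc m)) true) *P (X +P oneP))
      ≡⟨ coeff-+P (X +P oneP) (false ∷ ((List.replicate (suc m) true) *P (X +P oneP))) (suc i) ⟩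
    coeff i oneP xor coeff i ((List.replicate (suc m) true) *P (X +P oneP))
      ≡⟨ cong₂ _xor_ (coeff-X^P 0 i) (geometric m i) ⟩
    (i ≡ᵇ 0) xor ((i ≡ᵇ suc m) xor (i ≡ᵇ 0))
      ≡⟨ a+[b+a]≡b (i ≡ᵇ 0) (i ≡ᵇ suc m) ⟩
    (i ≡ᵇ suc m)
      ≡⟨ sym (xor-identityʳ _) ⟩
    (i ≡ᵇ suc m) xor false
      ∎
    where open ≡-Reasoning

infix 25 X^_·P_

X^_·P_ : ℕ → Poly → Poly
X^ j ·P q = List.replicate j false List.++ q

coeff-X^·P∷ : ∀ j c cs i → coeff i (X^ j ·P (c ∷ cs)) ≡ (c ∧ (i ≡ᵇ j)) xor coeff i (X^ suc j ·P cs)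
coeff-X^·P∷ zero    c cs zero    = sym (trans (xor-identityʳ _) (∧-identityʳ c))
coeff-X^·P∷ zero    c cs (suc i) = sym (cong (_xor coeff i cs) (∧-zeroʳ c))
coeff-X^·P∷ (suc j) c cs zero    = sym (cong (_xor false) (∧-zeroʳ c))
coeff-X^·P∷ (suc j) c cs (suc i) = coeff-X^·P∷ j c cs i

coeff-X^·P-below : ∀ j q {i} → i < j → coeff i (X^ j ·P q) ≡ false
coeff-X^·P-below (suc j) q {zero}  _         = refl
coeff-X^·P-below (suc j) q {suc i} (s≤s i<j) = coeff-X^·P-below j q i<j

coeff-X^·P[] : ∀ j i → coeff i (X^ j ·P []) ≡ false
coeff-X^·P[] zero    i       = refl
coeff-X^·P[] (suc j) zero    = refl
coeff-X^·P[] (suc j) (suc i) = coeff-X^·P[] j i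

Additive : ∀ {a b} → (Vec Bool a → Vec Bool b) → Set
Additive f = ∀ u v → f (u ⊕ v) ≡ f u ⊕ f v

additive-zeros : ∀ {a b} {f : Vec Bool a → Vec Bool b} → Additive f → f zeros ≡ zeros
additive-zeros {f = f} f-additive = begin
  f zeros               ≡⟨ cong f (sym (⊕-self zeros)) ⟩
  f (zeros ⊕ zeros)     ≡⟨ f-additive zeros zeros ⟩
  f zeros ⊕ f zeros     ≡⟨ ⊕-self (f zeros) ⟩
  zeros                 ∎
  where open ≡-Reasoning

additive-· : ∀ {a b} {f : Vec Bool a → Vec Bool b} → Additive f → ∀ c v → f (c · v) ≡ c · f v
additive-· f-additive true  v = refl
additive-· f-additive false v = additive-zeros f-additive

additive-vanishing-on-units : ∀ {d k} (f : Vec Bool d → Vec Bool k) → Additive f →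
  (∀ j → j < d → f (unit d j) ≡ zeros) → ∀ v → f v ≡ zeros
additive-vanishing-on-units {zero}  {k} f f-additive _      [] = additive-zeros f-additive
additive-vanishing-on-units {suc d} {k} f f-additive f-unit (b ∷ w) = begin
  f (b ∷ w)                                ≡⟨ cong f (split b) ⟩
  f (b · unit (suc d) 0 ⊕ (false ∷ w))     ≡⟨ f-additive _ _ ⟩
  f (b · unit (suc d) 0) ⊕ f (false ∷ w)   ≡⟨ cong₂ _⊕_ (additive-· f-additive b _) tail-vanishes ⟩
  b · f (unit (suc d) 0) ⊕ zeros           ≡⟨ cong (λ v → b · v ⊕ zeros) (f-unit 0 (s≤s z≤n)) ⟩
  b · zeros ⊕ zeros                        ≡⟨ cong (_⊕ zeros) (·-zeros b) ⟩
  zeros ⊕ zeros                            ≡⟨ ⊕-self zeros ⟩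
  zeros                                    ∎
  where
  open ≡-Reasoning
  split : ∀ b → b ∷ w ≡ b · unit (suc d) 0 ⊕ (false ∷ w)
  split true  = cong (true ∷_) (sym (trans (cong (_⊕ w) (tabulateℕ-false d)) (⊕-identityˡ w)))
  split false = cong (false ∷_) (sym (⊕-identityˡ w))
  tail-vanishes : f (false ∷ w) ≡ zeros
  tail-vanishes = additive-vanishing-on-units (λ v → f (false ∷ v)) (λ u v → f-additive (false ∷ u) (false ∷ v))
                    (λ j j<d → f-unit (suc j) (s≤s j<d)) w

evalAt-zero : ∀ {k} q (T : Vec Bool k → Vec Bool k) v → (∀ i → coeff i q ≡ false) → evalAt q T v ≡ zeros
evalAt-zero []           T v q≡0 = refl
evalAt-zero (false ∷ cs) T v q≡0 = trans (⊕-identityˡ _) (evalAt-zero cs T (T v) (q≡0 ∘ suc))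
evalAt-zero (true ∷ cs)  T v q≡0 with () ← q≡0 0

evalAt-constant : ∀ {k} q (T : Vec Bool k → Vec Bool k) v →
  (∀ i → coeff (suc i) q ≡ false) → evalAt q T v ≡ coeff 0 q · v
evalAt-constant []       T v q≡c = refl
evalAt-constant (c ∷ cs) T v q≡c = trans (cong (c · v ⊕_) (evalAt-zero cs T (T v) q≡c)) (⊕-identityʳ _)

module _ {k} {T : Vec Bool k → Vec Bool k} (T-additive : Additive T) where

  evalAt-additive : ∀ q → Additive (evalAt q T)
  evalAt-additive []       u v = sym (⊕-self zeros)
  evalAt-additive (c ∷ cs) u v = begin
    c · (u ⊕ v) ⊕ evalAt cs T (T (u ⊕ v))
      ≡⟨ cong₂ _⊕_ (·-⊕ c u v) (trans (cong (evalAt cs T) (T-additive u v)) (evalAt-additive cs (T u) (T v))) ⟩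
    (c · u ⊕ c · v) ⊕ (evalAt cs T (T u) ⊕ evalAt cs T (T v))
      ≡⟨ ⊕-interchange _ _ _ _ ⟩
    (c · u ⊕ evalAt cs T (T u)) ⊕ (c · v ⊕ evalAt cs T (T v))
      ∎
    where open ≡-Reasoning

  evalAt-commutes : ∀ q v → evalAt q T (T v) ≡ T (evalAt q T v)
  evalAt-commutes []       v = sym (additive-zeros T-additive)
  evalAt-commutes (c ∷ cs) v =
    trans (cong₂ _⊕_ (sym (additive-· T-additive c v)) (evalAt-commutes cs (T v))) (sym (T-additive _ _))

evalAt-intertwined : ∀ {a b} {L : Vec Bool a → Vec Bool a} {T : Vec Bool b → Vec Bool b}
                       {f : Vec Bool a → Vec Bool b} →
  Additive f → (∀ x → f (L x) ≡ T (f x)) → ∀ q x → f (evalAt q L x) ≡ evalAt q T (f x)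
evalAt-intertwined f-additive f∘L≡T∘f []       x = additive-zeros f-additive
evalAt-intertwined f-additive f∘L≡T∘f (c ∷ cs) x =
  trans (f-additive _ _)
    (cong₂ _⊕_ (additive-· f-additive c x)
      (trans (evalAt-intertwined f-additive f∘L≡T∘f cs _) (cong (evalAt cs _) (f∘L≡T∘f x))))

-- Companion modules

module Companion (e : ℕ) (p : Poly) where

  Q : Vec Bool (suc e) → Vec Bool (suc e)
  Q = xQuot (suc e) p

  ⟦_⟧ : Poly → Vec Bool (suc e)
  ⟦ q ⟧ = lowerCoeffs (suc e) q

  !-⟦⟧ : ∀ q {i} → i < suc e → ⟦ q ⟧ ! i ≡ coeff i q
  !-⟦⟧ q = !-tabulate (suc e) (λ i → coeff i q)

  Q-! : ∀ r {i} → i < suc e → Q r ! i ≡ (false ∷ init r) ! i xor (r ! e ∧ coeff i p)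
  Q-! r {i} i<d = begin
    Q r ! i
      ≡⟨ !-⊕ (false ∷ init r) (map (last r ∧_) ⟦ p ⟧) i ⟩
    (false ∷ init r) ! i xor map (last r ∧_) ⟦ p ⟧ ! i
      ≡⟨ cong ((false ∷ init r) ! i xor_) (!-map (last r ∧_) ⟦ p ⟧ i<d) ⟩
    (false ∷ init r) ! i xor (last r ∧ ⟦ p ⟧ ! i)
      ≡⟨ cong₂ (λ a b → (false ∷ init r) ! i xor (a ∧ b)) (last-! r) (!-⟦⟧ p i<d) ⟩
    (false ∷ init r) ! i xor (r ! e ∧ coeff i p)
      ∎
    where open ≡-Reasoning

  Q-!-zero : ∀ r → Q r ! 0 ≡ r ! e ∧ coeff 0 p
  Q-!-zero r = Q-! r (s≤s z≤n)

  Q-!-suc : ∀ r {i} → i < e → Q r ! suc i ≡ r ! i xor (r ! e ∧ coeff (suc i) p)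
  Q-!-suc r {i} i<e = trans (Q-! r (s≤s i<e)) (cong (_xor (r ! e ∧ coeff (suc i) p)) (!-init r i<e))

  shifted-additive : ∀ u v {i} → i < suc e →
    (false ∷ init (u ⊕ v)) ! i ≡ (false ∷ init u) ! i xor (false ∷ init v) ! i
  shifted-additive u v {zero}  _         = refl
  shifted-additive u v {suc i} (s≤s i<e) =
    trans (!-init (u ⊕ v) i<e) (trans (!-⊕ u v i) (sym (cong₂ _xor_ (!-init u i<e) (!-init v i<e))))

  Q-additive : Additive Q
  Q-additive u v = !-extensionality coordinate
    where
    coordinate : ∀ i → i < suc e → Q (u ⊕ v) ! i ≡ (Q u ⊕ Q v) ! i
    coordinate i i<d = begin
      Q (u ⊕ v) ! i
        ≡⟨ Q-! (u ⊕ v) i<d ⟩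
      shifted (u ⊕ v) xor top (u ⊕ v)
        ≡⟨ cong₂ _xor_ (shifted-additive u v i<d) top-additive ⟩
      (shifted u xor shifted v) xor (top u xor top v)
        ≡⟨ xor-interchange (shifted u) (shifted v) (top u) (top v) ⟩
      (shifted u xor top u) xor (shifted v xor top v)
        ≡⟨ sym (cong₂ _xor_ (Q-! u i<d) (Q-! v i<d)) ⟩
      Q u ! i xor Q v ! i
        ≡⟨ sym (!-⊕ (Q u) (Q v) i) ⟩
      (Q u ⊕ Q v) ! i
        ∎
      where
      open ≡-Reasoning
      shifted top : Vec Bool (suc e) → Bool
      shifted r = (false ∷ init r) ! i
      top r = r ! e ∧ coeff i p
      top-additive : top (u ⊕ v) ≡ top u xor top v
      top-additive = trans (cong (_∧ coeff i p) (!-⊕ u v e)) (∧-distribʳ-xor (coeff i p) (u ! e) (v ! e))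

  basis : ℕ → Vec Bool (suc e)
  basis = unit (suc e)

  !-basis : ∀ j {i} → i < suc e → basis j ! i ≡ (i ≡ᵇ j)
  !-basis j = !-tabulateℕ (suc e) (λ i → i ≡ᵇ j)

  Q-basis : ∀ {j} → j < e → Q (basis j) ≡ basis (suc j)
  Q-basis {j} j<e = !-extensionality coordinate
    where
    open ≡-Reasoning
    basis-top : basis j ! e ≡ false
    basis-top = trans (!-basis j ≤-refl) (≢⇒≡ᵇ-false (λ e≡j → <-irrefl (sym e≡j) j<e))
    coordinate : ∀ i → i < suc e → Q (basis j) ! i ≡ basis (suc j) ! i
    coordinate zero    _         = trans (Q-!-zero (basis j)) (cong (_∧ coeff 0 p) basis-top)
    coordinate (suc i) (s≤s i<e) = begin
      Q (basis j) ! suc i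
        ≡⟨ Q-!-suc (basis j) i<e ⟩
      basis j ! i xor (basis j ! e ∧ coeff (suc i) p)
        ≡⟨ cong₂ (λ a b → a xor (b ∧ coeff (suc i) p)) (!-basis j (m≤n⇒m≤1+n i<e)) basis-top ⟩
      (i ≡ᵇ j) xor false
        ≡⟨ xor-identityʳ _ ⟩
      (i ≡ᵇ j)
        ≡⟨ sym (!-basis (suc j) (s≤s i<e)) ⟩
      basis (suc j) ! suc i
        ∎

  Q-basis-last : Q (basis e) ≡ ⟦ p ⟧
  Q-basis-last = !-extensionality coordinate
    where
    open ≡-Reasoning
    basis-top : basis e ! e ≡ true
    basis-top = trans (!-basis e ≤-refl) (≡ᵇ-refl e)
    coordinate : ∀ i → i < suc e → Q (basis e) ! i ≡ ⟦ p ⟧ ! i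
    coordinate zero    d>0       =
      trans (Q-!-zero (basis e)) (trans (cong (_∧ coeff 0 p) basis-top) (sym (!-⟦⟧ p d>0)))
    coordinate (suc i) (s≤s i<e) = begin
      Q (basis e) ! suc i
        ≡⟨ Q-!-suc (basis e) i<e ⟩
      basis e ! i xor (basis e ! e ∧ coeff (suc i) p)
        ≡⟨ cong₂ (λ a b → a xor (b ∧ coeff (suc i) p)) (!-basis e (m≤n⇒m≤1+n i<e)) basis-top ⟩
      (i ≡ᵇ e) xor coeff (suc i) p
        ≡⟨ cong (_xor coeff (suc i) p) (≢⇒≡ᵇ-false (λ i≡e → <-irrefl i≡e i<e)) ⟩
      coeff (suc i) p
        ≡⟨ sym (!-⟦⟧ p (s≤s i<e)) ⟩
      ⟦ p ⟧ ! suc i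
        ∎

  ⟦X^·P∷⟧ : ∀ j c cs → ⟦ X^ j ·P (c ∷ cs) ⟧ ≡ c · basis j ⊕ ⟦ X^ suc j ·P cs ⟧
  ⟦X^·P∷⟧ j c cs = !-extensionality λ i i<d → begin
    ⟦ X^ j ·P (c ∷ cs) ⟧ ! i
      ≡⟨ !-⟦⟧ (X^ j ·P (c ∷ cs)) i<d ⟩
    coeff i (X^ j ·P (c ∷ cs))
      ≡⟨ coeff-X^·P∷ j c cs i ⟩
    (c ∧ (i ≡ᵇ j)) xor coeff i (X^ suc j ·P cs)
      ≡⟨ sym (cong₂ _xor_ (trans (!-· c (basis j) i) (cong (c ∧_) (!-basis j i<d))) (!-⟦⟧ (X^ suc j ·P cs) i<d)) ⟩
    (c · basis j) ! i xor ⟦ X^ suc j ·P cs ⟧ ! i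
      ≡⟨ sym (!-⊕ (c · basis j) ⟦ X^ suc j ·P cs ⟧ i) ⟩
    (c · basis j ⊕ ⟦ X^ suc j ·P cs ⟧) ! i
      ∎
    where open ≡-Reasoning

  ⟦X^d·P⟧ : ∀ cs → ⟦ X^ suc e ·P cs ⟧ ≡ zeros
  ⟦X^d·P⟧ cs = !-extensionality λ i i<d →
    trans (!-⟦⟧ (X^ suc e ·P cs) i<d) (trans (coeff-X^·P-below (suc e) cs i<d) (sym (!-zeros (suc e) i)))

  ⟦X^·P[]⟧ : ∀ j → ⟦ X^ j ·P [] ⟧ ≡ zeros
  ⟦X^·P[]⟧ j = !-extensionality λ i i<d →
    trans (!-⟦⟧ (X^ j ·P []) i<d) (trans (coeff-X^·P[] j i) (sym (!-zeros (suc e) i)))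

  -- Evaluation of q at the class of x^j, when x^j q has degree at most suc e = j + suc t:
  -- the part of degree below suc e is unchanged and x^(suc e) reduces to ⟦ p ⟧.
  horner : ∀ q t j → j + suc t ≡ suc e → (∀ k → suc t < k → coeff k q ≡ false) →
    evalAt q Q (basis j) ≡ ⟦ X^ j ·P q ⟧ ⊕ coeff (suc t) q · ⟦ p ⟧
  horner [] t j _ _ = sym (trans (cong (_⊕ zeros) (⟦X^·P[]⟧ j)) (⊕-self zeros))
  horner (c ∷ cs) (suc t) j j+t+2≡d above = begin
    c · basis j ⊕ evalAt cs Q (Q (basis j))
      ≡⟨ cong (λ v → c · basis j ⊕ evalAt cs Q v) (Q-basis j<e) ⟩
    c · basis j ⊕ evalAt cs Q (basis (suc j))
      ≡⟨ cong (c · basis j ⊕_) (horner cs t (suc j) j+1+t+1≡d (λ k t+1<k → above (suc k) (s≤s t+1<k))) ⟩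
    c · basis j ⊕ (⟦ X^ suc j ·P cs ⟧ ⊕ coeff (suc t) cs · ⟦ p ⟧)
      ≡⟨ sym (⊕-assoc (c · basis j) ⟦ X^ suc j ·P cs ⟧ (coeff (suc t) cs · ⟦ p ⟧)) ⟩
    (c · basis j ⊕ ⟦ X^ suc j ·P cs ⟧) ⊕ coeff (suc t) cs · ⟦ p ⟧
      ≡⟨ cong (_⊕ coeff (suc t) cs · ⟦ p ⟧) (sym (⟦X^·P∷⟧ j c cs)) ⟩
    ⟦ X^ j ·P (c ∷ cs) ⟧ ⊕ coeff (suc t) cs · ⟦ p ⟧
      ∎
    where
    open ≡-Reasoning
    j+1+t+1≡d : suc j + suc t ≡ suc e
    j+1+t+1≡d = trans (sym (+-suc j (suc t))) j+t+2≡d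
    j<e : j < e
    j<e = subst (j <_) (suc-injective j+1+t+1≡d) (m<m+n j (s≤s z≤n))
  horner (c ∷ cs) zero j j+1≡d above with trans (sym (+-identityʳ j)) (suc-injective (trans (sym (+-suc j 0)) j+1≡d))
  ... | refl = begin
    c · basis e ⊕ evalAt cs Q (Q (basis e))
      ≡⟨ cong (λ v → c · basis e ⊕ evalAt cs Q v) Q-basis-last ⟩
    c · basis e ⊕ evalAt cs Q ⟦ p ⟧
      ≡⟨ cong (c · basis e ⊕_) (evalAt-constant cs Q ⟦ p ⟧ (λ i → above (suc (suc i)) (s≤s (s≤s z≤n)))) ⟩
    c · basis e ⊕ coeff 0 cs · ⟦ p ⟧
      ≡⟨ cong (_⊕ coeff 0 cs · ⟦ p ⟧) (sym (trans (⟦X^·P∷⟧ e c cs)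
           (trans (cong (c · basis e ⊕_) (⟦X^d·P⟧ cs)) (⊕-identityʳ _)))) ⟩
    ⟦ X^ e ·P (c ∷ cs) ⟧ ⊕ coeff 0 cs · ⟦ p ⟧
      ∎
    where open ≡-Reasoning

  module _ (p-monic : Monic p) (deg-p : deg p ≡ suc e) where

    annihilates-basis₀ : evalAt p Q (basis 0) ≡ zeros
    annihilates-basis₀ = begin
      evalAt p Q (basis 0)
        ≡⟨ horner p e 0 refl (λ k d<k → coeff-above-deg p (subst (_< k) (sym deg-p) d<k)) ⟩
      ⟦ p ⟧ ⊕ coeff (suc e) p · ⟦ p ⟧
        ≡⟨ cong (λ c → ⟦ p ⟧ ⊕ c · ⟦ p ⟧) (subst (λ d → coeff d p ≡ true) deg-p p-monic) ⟩
      ⟦ p ⟧ ⊕ ⟦ p ⟧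
        ≡⟨ ⊕-self ⟦ p ⟧ ⟩
      zeros
        ∎
      where open ≡-Reasoning

    annihilates-basis : ∀ j → j < suc e → evalAt p Q (basis j) ≡ zeros
    annihilates-basis zero    _   = annihilates-basis₀
    annihilates-basis (suc j) j<e = begin
      evalAt p Q (basis (suc j))     ≡⟨ cong (evalAt p Q) (sym (Q-basis (s≤s⁻¹ j<e))) ⟩
      evalAt p Q (Q (basis j))       ≡⟨ evalAt-commutes Q-additive p (basis j) ⟩
      Q (evalAt p Q (basis j))       ≡⟨ cong Q (annihilates-basis j (m≤n⇒m≤1+n (s≤s⁻¹ j<e))) ⟩
      Q zeros                        ≡⟨ additive-zeros {f = Q} Q-additive ⟩
      zeros                          ∎
      where open ≡-Reasoning

    companion-annihilated : Annihilates p Q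
    companion-annihilated = additive-vanishing-on-units (evalAt p Q) (evalAt-additive Q-additive p) annihilates-basis

    -- A monic q of degree below suc e sends basis 0 to ⟦ q ⟧, which is nonzero at deg q.
    companion-minimal : IsMinimalPolynomial p Q
    companion-minimal = p-monic , companion-annihilated , minimal
      where
      minimal : ∀ q → Monic q → Annihilates q Q → deg p ≤ deg q
      minimal q q-monic q-annihilates with deg q <? suc e
      ... | no  deg-q≮d = subst (_≤ deg q) (sym deg-p) (≮⇒≥ deg-q≮d)
      ... | yes deg-q<d = contradiction (begin
        true
          ≡⟨ sym q-monic ⟩
        coeff (deg q) q
          ≡⟨ sym (!-⟦⟧ q deg-q<d) ⟩
        ⟦ q ⟧ ! deg q
          ≡⟨ cong (_! deg q) (sym (⊕-identityʳ ⟦ q ⟧)) ⟩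
        (⟦ q ⟧ ⊕ false · ⟦ p ⟧) ! deg q
          ≡⟨ cong (λ c → (⟦ q ⟧ ⊕ c · ⟦ p ⟧) ! deg q) (sym (q-above (suc e) ≤-refl)) ⟩
        (⟦ q ⟧ ⊕ coeff (suc e) q · ⟦ p ⟧) ! deg q
          ≡⟨ cong (_! deg q) (sym (horner q e 0 refl (λ k d<k → q-above k (<⇒≤ d<k)))) ⟩
        evalAt q Q (basis 0) ! deg q
          ≡⟨ cong (_! deg q) (q-annihilates (basis 0)) ⟩
        zeros {suc e} ! deg q
          ≡⟨ !-zeros (suc e) (deg q) ⟩
        false
          ∎) λ ()
        where
        open ≡-Reasoning
        q-above : ∀ k → suc e ≤ k → coeff k q ≡ false
        q-above k d≤k = coeff-above-deg q (≤-trans deg-q<d d≤k)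

-- Conjugacies and invariant factor decompositions

record Conjugacy {a b} (L : Vec Bool a → Vec Bool a) (T : Vec Bool b → Vec Bool b) : Set where
  field
    to             : Vec Bool a → Vec Bool b
    from           : Vec Bool b → Vec Bool a
    from∘to        : ∀ x → from (to x) ≡ x
    to∘from        : ∀ y → to (from y) ≡ y
    to-additive    : Additive to
    to-intertwines : ∀ x → to (L x) ≡ T (to x)

  from-zeros : from zeros ≡ zeros
  from-zeros = trans (cong from (sym (additive-zeros to-additive))) (from∘to zeros)

  annihilates-to : ∀ q → Annihilates q L → Annihilates q T
  annihilates-to q q-annihilates y = begin
    evalAt q T y                 ≡⟨ cong (evalAt q T) (sym (to∘from y)) ⟩
    evalAt q T (to (from y))     ≡⟨ sym (evalAt-intertwined to-additive to-intertwines q (from y)) ⟩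
    to (evalAt q L (from y))     ≡⟨ cong to (q-annihilates (from y)) ⟩
    to zeros                     ≡⟨ additive-zeros to-additive ⟩
    zeros                        ∎
    where open ≡-Reasoning

  annihilates-from : ∀ q → Annihilates q T → Annihilates q L
  annihilates-from q q-annihilates x = begin
    evalAt q L x                 ≡⟨ sym (from∘to _) ⟩
    from (to (evalAt q L x))     ≡⟨ cong from (evalAt-intertwined to-additive to-intertwines q x) ⟩
    from (evalAt q T (to x))     ≡⟨ cong from (q-annihilates (to x)) ⟩
    from zeros                   ≡⟨ from-zeros ⟩
    zeros                        ∎
    where open ≡-Reasoning

  minimalPolynomial : ∀ p → IsMinimalPolynomial p T → IsMinimalPolynomial p L
  minimalPolynomial p (p-monic , p-annihilates , p-minimal) =
    p-monic , annihilates-from p p-annihilates ,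
    λ q q-monic q-annihilates → p-minimal q q-monic (annihilates-to q q-annihilates)

_⊞_ : ∀ {a b} → (Vec Bool a → Vec Bool a) → (Vec Bool b → Vec Bool b) → Vec Bool (a + b) → Vec Bool (a + b)
_⊞_ {a} T₁ T₂ v = T₁ (take a v) ++ T₂ (drop a v)

take-++ : ∀ {a b} (y : Vec Bool a) (z : Vec Bool b) → take a (y ++ z) ≡ y
take-++ {a} y z = sym (proj₁ (++-injective y (take a (y ++ z)) (sym (take++drop≡id a (y ++ z)))))

drop-++ : ∀ {a b} (y : Vec Bool a) (z : Vec Bool b) → drop a (y ++ z) ≡ z
drop-++ {a} y z = sym (proj₂ (++-injective y (take a (y ++ z)) (sym (take++drop≡id a (y ++ z)))))

cyclic-decomposition : ∀ {n L} p → Monic p → deg p ≡ n → Conjugacy L (xQuot n p) →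
  IsInvariantFactorDecomposition n L (p ∷ [])
cyclic-decomposition p p-monic refl C =
  [ p-monic ] , wrap ,
  inverseᵇ⇒bijective (strictlyInverseˡ⇒inverseˡ wrap wrap∘unwrap , strictlyInverseʳ⇒inverseʳ wrap from∘to) ,
  (λ u v → cong (_, tt) (to-additive u v)) ,
  (λ x → cong (_, tt) (to-intertwines x))
  where
  open Conjugacy C
  wrap : _ → DSum (p ∷ [])
  wrap x = to x , tt
  unwrap : DSum (p ∷ []) → _
  unwrap (y , tt) = from y
  wrap∘unwrap : ∀ w → wrap (unwrap w) ≡ w
  wrap∘unwrap (y , tt) = cong (_, tt) (to∘from y)

two-factor-decomposition : ∀ {d₁ d₂ L} p₁ p₂ → Monic p₁ → p₁ ∣P p₂ → Monic p₂ →
  deg p₁ ≡ d₁ → deg p₂ ≡ d₂ → Conjugacy L (xQuot d₁ p₁ ⊞ xQuot d₂ p₂) →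
  IsInvariantFactorDecomposition (d₁ + d₂) L (p₁ ∷ p₂ ∷ [])
two-factor-decomposition {d₁} p₁ p₂ p₁-monic p₁∣p₂ p₂-monic refl refl C =
  ((p₁-monic , p₁∣p₂) ∷ [ p₂-monic ]) , split ,
  inverseᵇ⇒bijective
    (strictlyInverseˡ⇒inverseˡ split split∘join , strictlyInverseʳ⇒inverseʳ split join∘split) ,
  (λ u v → cong₂ (λ y z → y , z , tt)
             (trans (cong (take d₁) (to-additive u v)) (take-zipWith _xor_ (to u) (to v)))
             (trans (cong (drop d₁) (to-additive u v)) (drop-zipWith _xor_ (to u) (to v)))) ,
  (λ x → cong₂ (λ y z → y , z , tt)
             (trans (cong (take d₁) (to-intertwines x)) (take-++ (xQuot d₁ p₁ (take d₁ (to x))) _))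
             (trans (cong (drop d₁) (to-intertwines x)) (drop-++ (xQuot d₁ p₁ (take d₁ (to x))) _)))
  where
  open Conjugacy C
  split : _ → DSum (p₁ ∷ p₂ ∷ [])
  split x = take d₁ (to x) , drop d₁ (to x) , tt
  join : DSum (p₁ ∷ p₂ ∷ []) → _
  join (y , z , tt) = from (y ++ z)
  split∘join : ∀ w → split (join w) ≡ w
  split∘join (y , z , tt) = cong₂ (λ y z → y , z , tt)
    (trans (cong (take d₁) (to∘from (y ++ z))) (take-++ y z))
    (trans (cong (drop d₁) (to∘from (y ++ z))) (drop-++ y z))
  join∘split : ∀ x → join (split x) ≡ x
  join∘split x = trans (cong from (take++drop≡id d₁ (to x))) (from∘to x)

-- One sweep of the sequential update around the cycle

module _ {A : Set} {n : ℕ} (update : Fin n → A → A) (Inv : ℕ → A → Set)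
         (step : ∀ i j y → toℕ i ≡ j → Inv j y → Inv (suc j) (update i y)) where

  private
    sweep-from : ∀ k (h : Fin k → Fin n) j y → (∀ t → toℕ (h t) ≡ j + toℕ t) → Inv j y →
      Inv (j + k) (foldl (λ y i → update i y) y (List.tabulate h))
    sweep-from zero    h j y h≡ inv = subst (λ t → Inv t y) (sym (+-identityʳ j)) inv
    sweep-from (suc k) h j y h≡ inv =
      subst (λ t → Inv t (foldl (λ y i → update i y) (update (h fzero) y) (List.tabulate (h ∘ fsuc))))
        (sym (+-suc j k))
        (sweep-from k (h ∘ fsuc) (suc j) (update (h fzero) y)
          (λ t → trans (h≡ (fsuc t)) (+-suc j (toℕ t)))
          (step (h fzero) j y (trans (h≡ fzero) (+-identityʳ j)) inv))

  sweep : ∀ y → Inv 0 y → Inv n (foldl (λ y i → update i y) y (allFin n))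
  sweep y = sweep-from n (λ i → i) 0 y (λ _ → refl)

module CycleSweep {m : ℕ} (0<m : 0 < m) (x : Vec Bool (suc m)) where

  n = suc m

  final : ℕ → Bool
  final i = if i ≡ᵇ m then x ! 1 else (x ! 0 xor x ! m) xor x ! suc i

  final-< : ∀ {i} → i < m → final i ≡ (x ! 0 xor x ! m) xor x ! suc i
  final-< {i} i<m rewrite ≢⇒≡ᵇ-false (λ i≡m → <-irrefl i≡m i<m) = refl

  final-m : final m ≡ x ! 1
  final-m rewrite ≡ᵇ-refl m = refl

  Swept : ℕ → Vec Bool n → Set
  Swept j y = (∀ i → i < j → y ! i ≡ final i) × (∀ i → j ≤ i → y ! i ≡ x ! i)

  !-idx : ∀ (y : Vec Bool n) k → lookup y (idx n k) ≡ y ! (k % n)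
  !-idx y k = trans (!-lookup y (idx n k)) (cong (y !_) (toℕ-fromℕ< (m%n<n k n)))

  left-of-zero : (0 + m) % n ≡ m
  left-of-zero = m<n⇒m%n≡m ≤-refl

  left-of-suc : ∀ {j} → j < m → (suc j + m) % n ≡ j
  left-of-suc {j} j<m =
    trans (cong (_% n) (sym (+-suc j m))) (trans ([m+n]%n≡m%n j n) (m<n⇒m%n≡m (m≤n⇒m≤1+n j<m)))

  right-of : ∀ {j} → j < m → suc j % n ≡ suc j
  right-of j<m = m<n⇒m%n≡m (s≤s j<m)

  right-of-last : suc m % n ≡ 0
  right-of-last = n%n≡0 n

  neighbourhood : Vec Bool n → ℕ → Bool
  neighbourhood y j = y ! ((j + m) % n) xor y ! j xor y ! (suc j % n)

  neighbourhood-final : ∀ y j → j < n → Swept j y → neighbourhood y j ≡ final j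
  neighbourhood-final y zero _ (_ , untouched) = begin
    y ! ((0 + m) % n) xor y ! 0 xor y ! (1 % n)
      ≡⟨ cong₂ (λ a b → y ! a xor y ! 0 xor y ! b) left-of-zero (right-of 0<m) ⟩
    y ! m xor y ! 0 xor y ! 1
      ≡⟨ cong₂ _xor_ (untouched m z≤n) (cong₂ _xor_ (untouched 0 z≤n) (untouched 1 z≤n)) ⟩
    x ! m xor x ! 0 xor x ! 1
      ≡⟨ a+[b+c]≡[b+a]+c (x ! m) (x ! 0) (x ! 1) ⟩
    (x ! 0 xor x ! m) xor x ! 1
      ≡⟨ sym (final-< 0<m) ⟩
    final 0
      ∎
    where open ≡-Reasoning
  neighbourhood-final y (suc j) j<n (done , untouched) with suc j <? m
  ... | yes j+1<m = begin
    y ! ((suc j + m) % n) xor y ! suc j xor y ! (suc (suc j) % n)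
      ≡⟨ cong₂ (λ a b → y ! a xor y ! suc j xor y ! b) (left-of-suc (<⇒≤ j+1<m)) (right-of j+1<m) ⟩
    y ! j xor y ! suc j xor y ! suc (suc j)
      ≡⟨ cong₂ _xor_ (trans (done j ≤-refl) (final-< (<⇒≤ j+1<m)))
                     (cong₂ _xor_ (untouched (suc j) ≤-refl) (untouched (suc (suc j)) (n≤1+n _))) ⟩
    ((x ! 0 xor x ! m) xor x ! suc j) xor x ! suc j xor x ! suc (suc j)
      ≡⟨ [a+b]+[b+c]≡a+c (x ! 0 xor x ! m) (x ! suc j) (x ! suc (suc j)) ⟩
    (x ! 0 xor x ! m) xor x ! suc (suc j)
      ≡⟨ sym (final-< j+1<m) ⟩
    final (suc j)
      ∎
    where open ≡-Reasoning
  ... | no j+1≮m with ≤-antisym (s≤s⁻¹ j<n) (≮⇒≥ j+1≮m)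
  ...   | refl = begin
    y ! ((m + m) % n) xor y ! m xor y ! (suc m % n)
      ≡⟨ cong₂ (λ a b → y ! a xor y ! m xor y ! b) (left-of-suc ≤-refl) right-of-last ⟩
    y ! j xor y ! m xor y ! 0
      ≡⟨ cong₂ _xor_ (trans (done j ≤-refl) (final-< ≤-refl))
                     (cong₂ _xor_ (untouched m ≤-refl) (trans (done 0 0<m) (final-< 0<m))) ⟩
    ((x ! 0 xor x ! m) xor x ! m) xor x ! m xor (x ! 0 xor x ! m) xor x ! 1
      ≡⟨ [c+a]+[a+[c+b]]≡b (x ! 0 xor x ! m) (x ! m) (x ! 1) ⟩
    x ! 1
      ≡⟨ sym final-m ⟩
    final m
      ∎
    where open ≡-Reasoning

  step : ∀ i j y → toℕ i ≡ j → Swept j y → Swept (suc j) (localUpdate n i y)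
  step i j y refl (done , untouched) = done′ , untouched′
    where
    value≡final : lookup y (idx n (toℕ i + m)) xor lookup y i xor lookup y (idx n (suc (toℕ i))) ≡ final (toℕ i)
    value≡final = trans (cong₂ _xor_ (!-idx y (toℕ i + m)) (cong₂ _xor_ (!-lookup y i) (!-idx y (suc (toℕ i)))))
                        (neighbourhood-final y (toℕ i) (toℕ<n i) (done , untouched))
    done′ : ∀ k → k < suc (toℕ i) → localUpdate n i y ! k ≡ final k
    done′ k k≤j with k ≟ toℕ i
    ... | yes refl = trans (!-updated y i _) value≡final
    ... | no  k≢j  = trans (!-updated-other y i _ k≢j) (done k (≤∧≢⇒< (s≤s⁻¹ k≤j) k≢j))
    untouched′ : ∀ k → suc (toℕ i) ≤ k → localUpdate n i y ! k ≡ x ! k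
    untouched′ k j<k = trans (!-updated-other y i _ (λ k≡j → <-irrefl (sym k≡j) j<k)) (untouched k (<⇒≤ j<k))

  swept : Swept n (sdsParity n x)
  swept = sweep (localUpdate n) Swept step x ((λ _ ()) , (λ _ _ → refl))

sdsParity-! : ∀ {m} → 0 < m → (x : Vec Bool (suc m)) → ∀ {i} → i < m →
  sdsParity (suc m) x ! i ≡ (x ! 0 xor x ! m) xor x ! suc i
sdsParity-! 0<m x {i} i<m = trans (proj₁ swept i (m≤n⇒m≤1+n i<m)) (final-< i<m)
  where open CycleSweep 0<m x

sdsParity-!-last : ∀ {m} → 0 < m → (x : Vec Bool (suc m)) → sdsParity (suc m) x ! m ≡ x ! 1
sdsParity-!-last {m} 0<m x = trans (proj₁ swept m ≤-refl) final-m
  where open CycleSweep 0<m x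

-- The invariant factors

module Cycle (k : ℕ) where

  m n : ℕ
  m = suc (suc k)
  n = suc m

  L : Vec Bool n → Vec Bool n
  L = sdsParity n

  0<m : 0 < m
  0<m = s≤s z≤n

  δ : Vec Bool n → ℕ → Bool
  δ x i = x ! i xor x ! suc i

  reflect : (ℕ → Bool) → ℕ → Bool
  reflect f i = f (suc k ∸ i)

  reflect-involutive : ∀ f {i} → i ≤ suc k → reflect (reflect f) i ≡ f i
  reflect-involutive f i≤k+1 = cong f (m∸[m∸n]≡n i≤k+1)

  -- δ read backwards: L rotates the differences towards lower indices, while
  -- multiplication by x on a companion module shifts towards higher ones.
  rδ : Vec Bool n → ℕ → Bool
  rδ x = reflect (δ x)

  rδ-last : ∀ x → rδ x (suc k) ≡ δ x 0
  rδ-last x = cong (δ x) (n∸n≡0 (suc k))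

  parity : Vec Bool n → Bool
  parity x = xorSum n (x !_)

  parity⁺ : Vec Bool n → Bool
  parity⁺ x = xorSum m (λ i → x ! suc i)

  parity≡ : ∀ x → parity x ≡ x ! 0 xor parity⁺ x
  parity≡ x = xorSum-unshift m (x !_)

  parity⁺≡ : ∀ x → parity⁺ x ≡ x ! 0 xor parity x
  parity⁺≡ x = trans (sym (a+[a+b]≡b (x ! 0) (parity⁺ x))) (cong (x ! 0 xor_) (sym (parity≡ x)))

  δ-additive : ∀ u v i → δ (u ⊕ v) i ≡ δ u i xor δ v i
  δ-additive u v i =
    trans (cong₂ _xor_ (!-⊕ u v i) (!-⊕ u v (suc i))) (xor-interchange (u ! i) (v ! i) (u ! suc i) (v ! suc i))

  parity-additive : ∀ u v → parity (u ⊕ v) ≡ parity u xor parity v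
  parity-additive u v = trans (xorSum-cong n (λ i _ → !-⊕ u v i)) (xorSum-xor n (u !_) (v !_))

  parity⁺-additive : ∀ u v → parity⁺ (u ⊕ v) ≡ parity⁺ u xor parity⁺ v
  parity⁺-additive u v =
    trans (xorSum-cong m (λ i _ → !-⊕ u v (suc i))) (xorSum-xor m (λ i → u ! suc i) (λ i → v ! suc i))

  δ-L : ∀ x {i} → suc i < m → δ (L x) i ≡ δ x (suc i)
  δ-L x {i} i+1<m = trans (cong₂ _xor_ (sdsParity-! 0<m x (<⇒≤ i+1<m)) (sdsParity-! 0<m x i+1<m))
                          ([c+a]+[c+b]≡a+b (x ! 0 xor x ! m) (x ! suc i) (x ! suc (suc i)))

  δ-L-last : ∀ x → δ (L x) (suc k) ≡ δ x 0
  δ-L-last x =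
    trans (cong₂ _xor_ (sdsParity-! 0<m x ≤-refl) (sdsParity-!-last 0<m x)) ([[a+b]+b]+c≡a+c (x ! 0) (x ! m) (x ! 1))

  rδ-L-zero : ∀ x → rδ (L x) 0 ≡ rδ x (suc k)
  rδ-L-zero x = trans (δ-L-last x) (sym (rδ-last x))

  rδ-L-suc : ∀ x {j} → j < suc k → rδ (L x) (suc j) ≡ rδ x j
  rδ-L-suc x {j} j<k+1 =
    trans (δ-L x (s≤s (s≤s (m∸n≤m k j)))) (cong (δ x) (sym (+-∸-assoc 1 (s≤s⁻¹ j<k+1))))

  parity-L : ∀ x → parity (L x) ≡ (xorSum m (λ _ → x ! 0 xor x ! m) xor parity⁺ x) xor x ! 1
  parity-L x = cong₂ _xor_
    (trans (xorSum-cong m (λ i i<m → sdsParity-! 0<m x i<m))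
           (xorSum-xor m (λ _ → x ! 0 xor x ! m) (λ i → x ! suc i)))
    (sdsParity-!-last 0<m x)

  integrate : Bool → (ℕ → Bool) → Vec Bool n
  integrate a D = tabulateℕ n (λ i → a xor xorSum i D)

  integrate-! : ∀ a D {i} → i < n → integrate a D ! i ≡ a xor xorSum i D
  integrate-! a D = !-tabulateℕ n (λ i → a xor xorSum i D)

  δ-integrate : ∀ a D {i} → i < m → δ (integrate a D) i ≡ D i
  δ-integrate a D {i} i<m =
    trans (cong₂ _xor_ (integrate-! a D (m≤n⇒m≤1+n i<m)) (integrate-! a D (s≤s i<m)))
          ([a+b]+[a+[b+c]]≡c a (xorSum i D) (D i))

  integrate-δ : ∀ x D → (∀ i → i < m → D i ≡ δ x i) → integrate (x ! 0) D ≡ x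
  integrate-δ x D D≡δ = !-extensionality λ i i<n → begin
    integrate (x ! 0) D ! i
      ≡⟨ integrate-! (x ! 0) D i<n ⟩
    x ! 0 xor xorSum i D
      ≡⟨ cong (x ! 0 xor_) (xorSum-cong i (λ j j<i → D≡δ j (≤-trans j<i (s≤s⁻¹ i<n)))) ⟩
    x ! 0 xor xorSum i (δ x)
      ≡⟨ cong (x ! 0 xor_) (xorSum-telescope i (x !_)) ⟩
    x ! 0 xor (x ! 0 xor x ! i)
      ≡⟨ a+[a+b]≡b (x ! 0) (x ! i) ⟩
    x ! i
      ∎
    where open ≡-Reasoning

  Σ∫ : (ℕ → Bool) → Bool
  Σ∫ D = xorSum n (λ i → xorSum i D)

  Σ∫-cong : ∀ {D D′} → (∀ i → i < m → D i ≡ D′ i) → Σ∫ D ≡ Σ∫ D′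
  Σ∫-cong D≡D′ = xorSum-cong n (λ i i<n → xorSum-cong i (λ j j<i → D≡D′ j (≤-trans j<i (s≤s⁻¹ i<n))))

  parity-integrate : ∀ a D → parity (integrate a D) ≡ xorSum n (λ _ → a) xor Σ∫ D
  parity-integrate a D = trans (xorSum-cong n (λ i → integrate-! a D)) (xorSum-xor n (λ _ → a) (λ i → xorSum i D))

  rδ-integrate : ∀ a D j → rδ (integrate a D) j ≡ D (suc k ∸ j)
  rδ-integrate a D j = δ-integrate a D (s≤s (m∸n≤m (suc k) j))

  parity-δ : ∀ x → parity x ≡ xorSum n (λ _ → x ! 0) xor Σ∫ (δ x)
  parity-δ x = trans (cong parity (sym (integrate-δ x (δ x) (λ _ _ → refl)))) (parity-integrate (x ! 0) (δ x))

  differences : Vec Bool n → Vec Bool m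
  differences x = tabulateℕ m (rδ x)

  !-differences : ∀ x {j} → j < m → differences x ! j ≡ rδ x j
  !-differences x = !-tabulateℕ m (rδ x)

  differences-additive : Additive differences
  differences-additive u v = !-extensionality λ j j<m → begin
    differences (u ⊕ v) ! j
      ≡⟨ !-differences (u ⊕ v) j<m ⟩
    rδ (u ⊕ v) j
      ≡⟨ δ-additive u v (suc k ∸ j) ⟩
    rδ u j xor rδ v j
      ≡⟨ sym (cong₂ _xor_ (!-differences u j<m) (!-differences v j<m)) ⟩
    differences u ! j xor differences v ! j
      ≡⟨ sym (!-⊕ (differences u) (differences v) j) ⟩
    (differences u ⊕ differences v) ! j
      ∎
    where open ≡-Reasoning

  differences-reflect : ∀ x {i} → i < m → reflect (differences x !_) i ≡ δ x i
  differences-reflect x {i} i<m =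
    trans (!-differences x (s≤s (m∸n≤m (suc k) i))) (reflect-involutive (δ x) (s≤s⁻¹ i<m))

  differences-integrate : ∀ a D → differences (integrate a D) ≡ tabulateℕ m (reflect D)
  differences-integrate a D = !-extensionality λ j j<m →
    trans (!-differences (integrate a D) j<m) (trans (rδ-integrate a D j) (sym (!-tabulateℕ m (reflect D) j<m)))

  module Even (m-odd : ∀ c → xorSum m (λ _ → c) ≡ c) where

    n-even : ∀ c → xorSum n (λ _ → c) ≡ false
    n-even c = trans (cong (_xor c) (m-odd c)) (xor-same c)

    companions : Vec Bool n → Vec Bool n
    companions = xQuot 1 (X +P oneP) ⊞ xQuot m ((X ^P m) +P oneP)

    parity⁺-L : ∀ x → parity⁺ (L x) ≡ parity⁺ x
    parity⁺-L x = begin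
      parity⁺ (L x)
        ≡⟨ parity⁺≡ (L x) ⟩
      L x ! 0 xor parity (L x)
        ≡⟨ cong₂ _xor_ (sdsParity-! 0<m x (s≤s z≤n)) (parity-L x) ⟩
      (c xor x ! 1) xor ((xorSum m (λ _ → c) xor parity⁺ x) xor x ! 1)
        ≡⟨ cong (λ t → (c xor x ! 1) xor ((t xor parity⁺ x) xor x ! 1)) (m-odd c) ⟩
      (c xor x ! 1) xor ((c xor parity⁺ x) xor x ! 1)
        ≡⟨ [c+a]+[[c+b]+a]≡b c (x ! 1) (parity⁺ x) ⟩
      parity⁺ x
        ∎
      where
      open ≡-Reasoning
      c = x ! 0 xor x ! m

    to : Vec Bool n → Vec Bool n
    to x = parity⁺ x ∷ differences x

    from : Vec Bool n → Vec Bool n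
    from (b ∷ r) = integrate (b xor Σ∫ (reflect (r !_))) (reflect (r !_))

    from∘to : ∀ x → from (to x) ≡ x
    from∘to x = trans (cong (λ a → integrate a D) first) (integrate-δ x D (λ i → differences-reflect x))
      where
      D = reflect (differences x !_)
      first : parity⁺ x xor Σ∫ D ≡ x ! 0
      first = begin
        parity⁺ x xor Σ∫ D
          ≡⟨ cong (parity⁺ x xor_) (Σ∫-cong (λ i → differences-reflect x)) ⟩
        parity⁺ x xor Σ∫ (δ x)
          ≡⟨ cong (λ t → parity⁺ x xor (t xor Σ∫ (δ x))) (sym (n-even (x ! 0))) ⟩
        parity⁺ x xor (xorSum n (λ _ → x ! 0) xor Σ∫ (δ x))
          ≡⟨ cong (parity⁺ x xor_) (sym (parity-δ x)) ⟩
        parity⁺ x xor parity x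
          ≡⟨ cong (parity⁺ x xor_) (parity≡ x) ⟩
        parity⁺ x xor (x ! 0 xor parity⁺ x)
          ≡⟨ a+[b+a]≡b (parity⁺ x) (x ! 0) ⟩
        x ! 0
          ∎
        where open ≡-Reasoning

    to∘from : ∀ w → to (from w) ≡ w
    to∘from (b ∷ r) = cong₂ _∷_ first (trans (differences-integrate a D) (!-extensionality λ j j<m →
                        trans (!-tabulateℕ m (reflect D) j<m) (reflect-involutive (r !_) (s≤s⁻¹ j<m))))
      where
      open ≡-Reasoning
      D = reflect (r !_)
      a = b xor Σ∫ D
      first : parity⁺ (integrate a D) ≡ b
      first = begin
        parity⁺ (integrate a D)
          ≡⟨ parity⁺≡ (integrate a D) ⟩
        integrate a D ! 0 xor parity (integrate a D)
          ≡⟨ cong₂ _xor_ (xor-identityʳ a) (parity-integrate a D) ⟩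
        a xor (xorSum n (λ _ → a) xor Σ∫ D)
          ≡⟨ cong (λ t → a xor (t xor Σ∫ D)) (n-even a) ⟩
        (b xor Σ∫ D) xor Σ∫ D
          ≡⟨ [a+b]+b≡a b (Σ∫ D) ⟩
        b
          ∎

    to-additive : Additive to
    to-additive u v = cong₂ _∷_ (parity⁺-additive u v) (differences-additive u v)

    to-intertwines : ∀ x → to (L x) ≡ companions (to x)
    to-intertwines x = cong₂ _∷_ (trans (parity⁺-L x) (sym (∧-identityʳ _))) (!-extensionality coordinate)
      where
      open Companion (suc k) ((X ^P m) +P oneP)
      coordinate : ∀ j → j < m → differences (L x) ! j ≡ Q (differences x) ! j
      coordinate zero    j<m = begin
        differences (L x) ! 0                    ≡⟨ !-differences (L x) j<m ⟩
        rδ (L x) 0                               ≡⟨ rδ-L-zero x ⟩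
        rδ x (suc k)                             ≡⟨ sym (!-differences x ≤-refl) ⟩
        differences x ! suc k                    ≡⟨ sym (∧-identityʳ _) ⟩
        differences x ! suc k ∧ true             ≡⟨ sym (Q-!-zero (differences x)) ⟩
        Q (differences x) ! 0                    ∎
        where open ≡-Reasoning
      coordinate (suc j) j<m = begin
        differences (L x) ! suc j
          ≡⟨ !-differences (L x) j<m ⟩
        rδ (L x) (suc j)
          ≡⟨ rδ-L-suc x (s≤s⁻¹ j<m) ⟩
        rδ x j
          ≡⟨ sym (!-differences x (m≤n⇒m≤1+n (s≤s⁻¹ j<m))) ⟩
        differences x ! j
          ≡⟨ sym (xor-identityʳ _) ⟩
        differences x ! j xor false
          ≡⟨ cong (differences x ! j xor_) (sym (∧-zeroʳ _)) ⟩
        differences x ! j xor (differences x ! suc k ∧ false)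
          ≡⟨ cong (λ c → differences x ! j xor (differences x ! suc k ∧ c)) (sym gap) ⟩
        differences x ! j xor (differences x ! suc k ∧ coeff (suc j) ((X ^P m) +P oneP))
          ≡⟨ sym (Q-!-suc (differences x) (s≤s⁻¹ j<m)) ⟩
        Q (differences x) ! suc j
          ∎
        where
        open ≡-Reasoning
        gap : coeff (suc j) ((X ^P m) +P oneP) ≡ false
        gap = trans (coeff-X^P+1 m (suc j))
                    (cong (_xor false) (≢⇒≡ᵇ-false (λ j≡k+1 → <-irrefl j≡k+1 (s≤s⁻¹ j<m))))

    conjugacy : Conjugacy L companions
    conjugacy = record { to = to ; from = from ; from∘to = from∘to ; to∘from = to∘from
                       ; to-additive = to-additive ; to-intertwines = to-intertwines }

  module Odd (m-even : ∀ c → xorSum m (λ _ → c) ≡ false) where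

    n-odd : ∀ c → xorSum n (λ _ → c) ≡ c
    n-odd c = cong (_xor c) (m-even c)

    p : Poly
    p = (X +P oneP) *P ((X ^P m) +P oneP)

    coeff-p-suc : ∀ i → coeff (suc i) p ≡ ((i ≡ᵇ m) xor (i ≡ᵇ 0)) xor ((i ≡ᵇ suc k) xor false)
    coeff-p-suc i = trans (coeff-[X+1]*P-suc ((X ^P m) +P oneP) i) (cong₂ _xor_ (coeff-X^P+1 m i) (coeff-X^P+1 m (suc i)))

    coeff-p-0 : coeff 0 p ≡ true
    coeff-p-0 = trans (coeff-[X+1]*P-zero ((X ^P m) +P oneP)) (coeff-X^P+1 m 0)

    coeff-p-1 : coeff 1 p ≡ true
    coeff-p-1 = coeff-p-suc 0

    coeff-p-middle : ∀ {j} → j < k → coeff (suc (suc j)) p ≡ false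
    coeff-p-middle {j} j<k
      rewrite coeff-p-suc (suc j)
            | ≢⇒≡ᵇ-false {j} {suc k} (λ j≡k+1 → <-irrefl j≡k+1 (m≤n⇒m≤1+n j<k))
            | ≢⇒≡ᵇ-false {j} {k} (λ j≡k → <-irrefl j≡k j<k) = refl

    coeff-p-m : coeff m p ≡ true
    coeff-p-m rewrite coeff-p-suc (suc k)
                    | ≢⇒≡ᵇ-false {k} {suc k} (λ k≡k+1 → <-irrefl k≡k+1 ≤-refl)
                    | ≡ᵇ-refl k = refl

    coeff-p-n : coeff n p ≡ true
    coeff-p-n rewrite coeff-p-suc m
                    | ≡ᵇ-refl k
                    | ≢⇒≡ᵇ-false {suc k} {k} (λ k+1≡k → <-irrefl (sym k+1≡k) ≤-refl) = refl

    coeff-p-above : ∀ i → n < i → coeff i p ≡ false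
    coeff-p-above (suc i) n<i
      rewrite coeff-p-suc i
            | ≢⇒≡ᵇ-false {i} {m} (λ i≡m → <-irrefl (sym i≡m) (s≤s⁻¹ n<i))
            | ≢⇒≡ᵇ-false {i} {suc k} (λ i≡k+1 → <-irrefl (sym i≡k+1) (<-trans (n<1+n (suc k)) (s≤s⁻¹ n<i)))
            | ≢⇒≡ᵇ-false {i} {0} (λ i≡0 → <-irrefl (sym i≡0) (<-trans (s≤s z≤n) (s≤s⁻¹ n<i))) = refl

    deg-p : deg p ≡ n
    deg-p = deg-≡ p n coeff-p-n coeff-p-above

    p-monic : Monic p
    p-monic = monic-deg-≡ p n coeff-p-n coeff-p-above

    parity-L-odd : ∀ x → parity (L x) ≡ parity x xor δ x 0
    parity-L-odd x = begin
      parity (L x)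
        ≡⟨ parity-L x ⟩
      (xorSum m (λ _ → x ! 0 xor x ! m) xor parity⁺ x) xor x ! 1
        ≡⟨ cong (λ t → (t xor parity⁺ x) xor x ! 1) (m-even _) ⟩
      parity⁺ x xor x ! 1
        ≡⟨ sym ([c+a]+[c+b]≡a+b (x ! 0) (parity⁺ x) (x ! 1)) ⟩
      (x ! 0 xor parity⁺ x) xor (x ! 0 xor x ! 1)
        ≡⟨ cong (_xor δ x 0) (sym (parity≡ x)) ⟩
      parity x xor δ x 0
        ∎
      where open ≡-Reasoning

    -- Multiplication by x on 𝔽₂[x]/(p), p = 1 + x + x^m + x^(m+1), sends (r₀, …, r_m) to
    -- (r_m, r₀ + r_m, r₁, …, r_{m-2}, r_{m-1} + r_m); since parity (L x) = parity x + δ x 0,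
    -- the coordinates (rδ₀ + parity, rδ₁, …, rδ_{m-1}, parity) transform in exactly this way.
    cyclicCoordinate : Vec Bool n → ℕ → Bool
    cyclicCoordinate x zero    = rδ x 0 xor parity x
    cyclicCoordinate x (suc j) = if j ≡ᵇ suc k then parity x else rδ x (suc j)

    cyclicCoordinate-last : ∀ x → cyclicCoordinate x m ≡ parity x
    cyclicCoordinate-last x rewrite ≡ᵇ-refl k = refl

    cyclicCoordinate-inner : ∀ x {j} → j < suc k → cyclicCoordinate x (suc j) ≡ rδ x (suc j)
    cyclicCoordinate-inner x {j} j<k+1 rewrite ≢⇒≡ᵇ-false (λ j≡k+1 → <-irrefl j≡k+1 j<k+1) = refl

    cyclicCoordinate-additive : ∀ u v j → cyclicCoordinate (u ⊕ v) j ≡ cyclicCoordinate u j xor cyclicCoordinate v j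
    cyclicCoordinate-additive u v zero =
      trans (cong₂ _xor_ (δ-additive u v (suc k)) (parity-additive u v))
            (xor-interchange (rδ u 0) (rδ v 0) (parity u) (parity v))
    cyclicCoordinate-additive u v (suc j) with j ≡ᵇ suc k
    ... | true  = parity-additive u v
    ... | false = δ-additive u v (suc k ∸ suc j)

    to : Vec Bool n → Vec Bool n
    to x = tabulateℕ n (cyclicCoordinate x)

    !-to : ∀ x {j} → j < n → to x ! j ≡ cyclicCoordinate x j
    !-to x = !-tabulateℕ n (cyclicCoordinate x)

    cyclicDifference : Vec Bool n → ℕ → Bool
    cyclicDifference r zero    = r ! 0 xor r ! m
    cyclicDifference r (suc j) = r ! suc j

    cyclicDifference-to : ∀ x {j} → j ≤ suc k → cyclicDifference (to x) j ≡ rδ x j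
    cyclicDifference-to x {zero} _ = begin
      to x ! 0 xor to x ! m
        ≡⟨ cong₂ _xor_ (!-to x (s≤s z≤n)) (trans (!-to x ≤-refl) (cyclicCoordinate-last x)) ⟩
      (rδ x 0 xor parity x) xor parity x
        ≡⟨ [a+b]+b≡a (rδ x 0) (parity x) ⟩
      rδ x 0
        ∎
      where open ≡-Reasoning
    cyclicDifference-to x {suc j} j<k+1 = trans (!-to x (m≤n⇒m≤1+n (s≤s j<k+1))) (cyclicCoordinate-inner x j<k+1)

    from : Vec Bool n → Vec Bool n
    from r = integrate (r ! m xor Σ∫ (reflect (cyclicDifference r))) (reflect (cyclicDifference r))

    from∘to : ∀ x → from (to x) ≡ x
    from∘to x = trans (cong (λ a → integrate a D) first) (integrate-δ x D D≡δ)
      where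
      D = reflect (cyclicDifference (to x))
      D≡δ : ∀ i → i < m → D i ≡ δ x i
      D≡δ i i<m = trans (cyclicDifference-to x (m∸n≤m (suc k) i)) (reflect-involutive (δ x) (s≤s⁻¹ i<m))
      first : to x ! m xor Σ∫ D ≡ x ! 0
      first = begin
        to x ! m xor Σ∫ D
          ≡⟨ cong₂ _xor_ (trans (!-to x ≤-refl) (cyclicCoordinate-last x)) (Σ∫-cong D≡δ) ⟩
        parity x xor Σ∫ (δ x)
          ≡⟨ cong (_xor Σ∫ (δ x)) (trans (parity-δ x) (cong (_xor Σ∫ (δ x)) (n-odd (x ! 0)))) ⟩
        (x ! 0 xor Σ∫ (δ x)) xor Σ∫ (δ x)
          ≡⟨ [a+b]+b≡a (x ! 0) (Σ∫ (δ x)) ⟩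
        x ! 0
          ∎
        where open ≡-Reasoning

    to∘from : ∀ r → to (from r) ≡ r
    to∘from r = !-extensionality coordinate
      where
      D = reflect (cyclicDifference r)
      a = r ! m xor Σ∫ D
      y = integrate a D
      parity-y : parity y ≡ r ! m
      parity-y = trans (parity-integrate a D) (trans (cong (_xor Σ∫ D) (n-odd a)) ([a+b]+b≡a (r ! m) (Σ∫ D)))
      rδ-y : ∀ j → j ≤ suc k → rδ y j ≡ cyclicDifference r j
      rδ-y j j≤k+1 = trans (rδ-integrate a D j) (reflect-involutive (cyclicDifference r) j≤k+1)
      coordinate : ∀ j → j < n → to y ! j ≡ r ! j
      coordinate zero    _       = trans (!-to y (s≤s z≤n))
        (trans (cong₂ _xor_ (rδ-y 0 z≤n) parity-y) ([a+b]+b≡a (r ! 0) (r ! m)))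
      coordinate (suc j) j+1<n with m≤n⇒m<n∨m≡n (s≤s⁻¹ j+1<n)
      ... | inj₁ j<k+1 =
        trans (!-to y j+1<n) (trans (cyclicCoordinate-inner y (s≤s⁻¹ j<k+1)) (rδ-y (suc j) (s≤s⁻¹ j<k+1)))
      ... | inj₂ refl  = trans (!-to y j+1<n) (trans (cyclicCoordinate-last y) parity-y)

    to-additive : Additive to
    to-additive u v = !-extensionality λ j j<n →
      trans (!-to (u ⊕ v) j<n) (trans (cyclicCoordinate-additive u v j)
        (sym (trans (!-⊕ (to u) (to v) j) (cong₂ _xor_ (!-to u j<n) (!-to v j<n)))))

    to-intertwines : ∀ x → to (L x) ≡ xQuot n p (to x)
    to-intertwines x = !-extensionality coordinate
      where
      open Companion m p
      open ≡-Reasoning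
      r = to x
      r-last : r ! m ≡ parity x
      r-last = trans (!-to x ≤-refl) (cyclicCoordinate-last x)
      r-inner : ∀ {j} → j < suc k → r ! suc j ≡ rδ x (suc j)
      r-inner j<k+1 = trans (!-to x (s≤s (m≤n⇒m≤1+n j<k+1))) (cyclicCoordinate-inner x j<k+1)
      coordinate : ∀ j → j < n → to (L x) ! j ≡ Q r ! j
      coordinate zero _ = begin
        to (L x) ! 0
          ≡⟨ !-to (L x) (s≤s z≤n) ⟩
        rδ (L x) 0 xor parity (L x)
          ≡⟨ cong₂ _xor_ (rδ-L-zero x) (parity-L-odd x) ⟩
        rδ x (suc k) xor (parity x xor δ x 0)
          ≡⟨ cong (_xor (parity x xor δ x 0)) (rδ-last x) ⟩
        δ x 0 xor (parity x xor δ x 0)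
          ≡⟨ a+[b+a]≡b (δ x 0) (parity x) ⟩
        parity x
          ≡⟨ sym (trans (Q-!-zero r) (trans (cong₂ _∧_ r-last coeff-p-0) (∧-identityʳ _))) ⟩
        Q r ! 0
          ∎
      coordinate (suc zero) _ = begin
        to (L x) ! 1
          ≡⟨ trans (!-to (L x) (s≤s (s≤s z≤n))) (cyclicCoordinate-inner (L x) (s≤s z≤n)) ⟩
        rδ (L x) 1
          ≡⟨ rδ-L-suc x (s≤s z≤n) ⟩
        rδ x 0
          ≡⟨ sym ([a+b]+b≡a (rδ x 0) (parity x)) ⟩
        (rδ x 0 xor parity x) xor parity x
          ≡⟨ sym (cong₂ _xor_ (!-to x (s≤s z≤n)) (trans (cong₂ _∧_ r-last coeff-p-1) (∧-identityʳ _))) ⟩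
        r ! 0 xor (r ! m ∧ coeff 1 p)
          ≡⟨ sym (Q-!-suc r (s≤s z≤n)) ⟩
        Q r ! 1
          ∎
      coordinate (suc (suc j)) j+2<n with m≤n⇒m<n∨m≡n (s≤s⁻¹ (s≤s⁻¹ j+2<n))
      ... | inj₁ j+1<k+1 = begin
        to (L x) ! suc (suc j)
          ≡⟨ trans (!-to (L x) j+2<n) (cyclicCoordinate-inner (L x) j+1<k+1) ⟩
        rδ (L x) (suc (suc j))
          ≡⟨ rδ-L-suc x j+1<k+1 ⟩
        rδ x (suc j)
          ≡⟨ sym (xor-identityʳ _) ⟩
        rδ x (suc j) xor false
          ≡⟨ sym (cong₂ _xor_ (r-inner (m≤n⇒m≤1+n (s≤s⁻¹ j+1<k+1)))
                              (trans (cong (r ! m ∧_) (coeff-p-middle (s≤s⁻¹ j+1<k+1))) (∧-zeroʳ _))) ⟩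
        r ! suc j xor (r ! m ∧ coeff (suc (suc j)) p)
          ≡⟨ sym (Q-!-suc r (m≤n⇒m≤1+n j+1<k+1)) ⟩
        Q r ! suc (suc j)
          ∎
      ... | inj₂ refl = begin
        to (L x) ! m
          ≡⟨ trans (!-to (L x) ≤-refl) (cyclicCoordinate-last (L x)) ⟩
        parity (L x)
          ≡⟨ parity-L-odd x ⟩
        parity x xor δ x 0
          ≡⟨ xor-comm (parity x) (δ x 0) ⟩
        δ x 0 xor parity x
          ≡⟨ cong (_xor parity x) (sym (rδ-last x)) ⟩
        rδ x (suc k) xor parity x
          ≡⟨ sym (cong₂ _xor_ (r-inner ≤-refl) (trans (cong₂ _∧_ r-last coeff-p-m) (∧-identityʳ _))) ⟩
        r ! suc k xor (r ! m ∧ coeff m p)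
          ≡⟨ sym (Q-!-suc r ≤-refl) ⟩
        Q r ! m
          ∎

    conjugacy : Conjugacy L (xQuot n p)
    conjugacy = record { to = to ; from = from ; from∘to = from∘to ; to∘from = to∘from
                       ; to-additive = to-additive ; to-intertwines = to-intertwines }

lemma4p6 : (n : ℕ) .{{_ : NonZero n}} → 3 ≤ n →
    ((k : ℕ) → n ≡ 2 * k →
      IsInvariantFactorDecomposition n (sdsParity n)
        ((X +P oneP) ∷ ((X ^P (n ∸ 1)) +P oneP) ∷ []))
    × ((k : ℕ) → n ≡ suc (2 * k) →
      IsInvariantFactorDecomposition n (sdsParity n)
        (((X +P oneP) *P ((X ^P (n ∸ 1)) +P oneP)) ∷ [])
      × IsMinimalPolynomial ((X +P oneP) *P ((X ^P (n ∸ 1)) +P oneP)) (sdsParity n))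
lemma4p6 (suc (suc (suc k))) (s≤s (s≤s (s≤s _))) = even-case , odd-case
  where
  open Cycle k

  even-case : ∀ t → n ≡ 2 * t → IsInvariantFactorDecomposition n L ((X +P oneP) ∷ ((X ^P m) +P oneP) ∷ [])
  even-case t n≡2t =
    two-factor-decomposition (X +P oneP) ((X ^P m) +P oneP) refl (X+1∣X^P+1 (suc k)) (monic-X^P+1 (suc k))
      refl (deg-X^P+1 (suc k)) (Even.conjugacy m-odd)
    where
    m-odd : ∀ c → xorSum m (λ _ → c) ≡ c
    m-odd c = a+b≡false⇒a≡b (trans (cong (λ i → xorSum i (λ _ → c)) n≡2t) (xorSum-const-double t c))

  odd-case : ∀ t → n ≡ suc (2 * t) →
    IsInvariantFactorDecomposition n L (((X +P oneP) *P ((X ^P m) +P oneP)) ∷ [])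
    × IsMinimalPolynomial ((X +P oneP) *P ((X ^P m) +P oneP)) L
  odd-case t n≡2t+1 =
    cyclic-decomposition p p-monic deg-p conjugacy ,
    Conjugacy.minimalPolynomial conjugacy p (Companion.companion-minimal m p p-monic deg-p)
    where
    open Odd (λ c → trans (cong (λ i → xorSum i (λ _ → c)) (suc-injective n≡2t+1)) (xorSum-const-double t c))
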